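{- Let $n \in \mathbb{N}$ and let $(m_1,\dots,m_n)$ be an $n$-tuple of natural numbers such that $\sum_{i=1}^n m_i$ is even. There is a partition $\{A,B\}$ of $[n]=\{1,\dots,n\}$ with $\sum_{i\in A} m_i = \sum_{j \in B} m_j$ if and only if the disjoint union of stars $G = \sum_{i=1}^n K_{1,m_i+1}$ is equitably 2-colorable.
   Context: $\mathbb{N}=\{1,2,3,\dots\}$. A proper $k$-coloring of a graph $G$ is an equitable $k$-coloring if the sizes of its $k$ color classes differ by at most 1; $G$ is equitably $k$-colorable if it has an equitable $k$-coloring. -}

module Defs where

open import Data.Nat using (ℕ; zero; suc; _+_; _≤_)
open import Data.Fin using (Fin; zero; suc)
open import Data.Fin.Properties using (_≟_)
open import Data.Bool using (Bool; true; false; if_then_else_)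
open import Data.List using (List; []; _∷_; map; concat; allFin; filter; length)
open import Data.List.Membership.Propositional using (_∈_)
open import Data.List.Membership.Propositional.Properties using (∈-map⁺; ∈-map⁻; ∈-concat⁺′)
open import Data.List.Relation.Unary.Unique.Propositional using (Unique)
import Data.List.Relation.Unary.Unique.Propositional.Properties as UP
open import Data.List.Relation.Unary.All as All using (All)
import Data.List.Relation.Unary.All.Properties as AllP
import Data.List.Relation.Unary.AllPairs as AllPairs
import Data.List.Relation.Unary.AllPairs.Properties as APP
open import Data.List.Relation.Binary.Disjoint.Propositional using (Disjoint)
open import Data.Product using (Σ; _×_; _,_; proj₁; proj₂)
open import Data.Product.Properties using (Σ-≡,≡←≡)
open import Data.Sum using (_⊎_)
open import Relation.Binary.PropositionalEquality using (_≡_; _≢_; refl; sym; trans; cong; subst)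
open import Axiom.UniquenessOfIdentityProofs using (module Decidable⇒UIP)
open import Relation.Nullary using (¬_)

record FinGraph : Set₁ where
  field
    V        : Set
    Adj      : V → V → Set
    vertices : List V
    complete : ∀ v → v ∈ vertices
    unique   : Unique vertices
    sym-Adj  : ∀ {u v} → Adj u v → Adj v u
    irrefl   : ∀ {v} → ¬ Adj v v

open FinGraph public

Proper : (G : FinGraph) (k : ℕ) → (V G → Fin k) → Set
Proper G k c = ∀ u v → Adj G u v → c u ≢ c v

classSize : (G : FinGraph) (k : ℕ) → (V G → Fin k) → Fin k → ℕ
classSize G k c a = length (filter (λ v → c v ≟ a) (vertices G))

EquitableColoring : (G : FinGraph) (k : ℕ) → (V G → Fin k) → Set
EquitableColoring G k c =
  Proper G k c × (∀ a b → classSize G k c a ≤ suc (classSize G k c b))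

EquitablyColorable : FinGraph → ℕ → Set
EquitablyColorable G k = Σ (V G → Fin k) (EquitableColoring G k)

-- Vertices: pairs (i , j) with i : Fin n and j : Fin (suc (s i));
-- j = zero is the center of the i-th star, j = suc l are its s i leaves.

StarV : (n : ℕ) → (Fin n → ℕ) → Set
StarV n s = Σ (Fin n) (λ i → Fin (suc (s i)))

IsCenter : ∀ {n s} → StarV n s → Set
IsCenter (i , j) = j ≡ zero

IsLeaf : ∀ {n s} → StarV n s → Set
IsLeaf (i , j) = j ≢ zero

StarAdj : ∀ {n s} → StarV n s → StarV n s → Set
StarAdj u v = proj₁ u ≡ proj₁ v × ((IsCenter u × IsLeaf v) ⊎ (IsLeaf u × IsCenter v))

starVertices : (n : ℕ) (s : Fin n → ℕ) → List (StarV n s)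
starVertices n s = concat (map (λ i → map (i ,_) (allFin (suc (s i)))) (allFin n))

private
  module _ {n : ℕ} {s : Fin n → ℕ} where
    open Data.Sum using (inj₁; inj₂)

    pairInj : ∀ (i : Fin n) {a b : Fin (suc (s i))} → _≡_ {A = StarV n s} (i , a) (i , b) → a ≡ b
    pairInj i eq with Σ-≡,≡←≡ eq
    ... | p , q = trans (cong (λ r → subst (λ x → Fin (suc (s x))) r _) (sym (Decidable⇒UIP.≡-irrelevant _≟_ p refl))) q

    block : Fin n → List (StarV n s)
    block i = map (i ,_) (allFin (suc (s i)))

    starComplete : ∀ v → v ∈ starVertices n s
    starComplete (i , j) = ∈-concat⁺′ (∈-map⁺ (i ,_) (Data.List.Membership.Propositional.Properties.∈-allFin j))
                                      (∈-map⁺ block (Data.List.Membership.Propositional.Properties.∈-allFin i))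

    blocksDisjoint : ∀ {i i′} → i ≢ i′ → Disjoint (block i) (block i′)
    blocksDisjoint i≢i′ (v∈ , v∈′) with ∈-map⁻ (_ ,_) v∈ | ∈-map⁻ (_ ,_) v∈′
    ... | _ , _ , refl | _ , _ , eq = i≢i′ (cong proj₁ eq)

    starUnique : Unique (starVertices n s)
    starUnique = UP.concat⁺
      (AllP.map⁺ (All.universal (λ i → UP.map⁺ (pairInj i) (UP.allFin⁺ _)) _))
      (APP.map⁺ (AllPairs.map blocksDisjoint (UP.allFin⁺ n)))

    starSym : ∀ {u v : StarV n s} → StarAdj u v → StarAdj v u
    starSym (p , inj₁ (c , l)) = sym p , inj₂ (l , c)
    starSym (p , inj₂ (l , c)) = sym p , inj₁ (c , l)

    starIrrefl : ∀ {v : StarV n s} → ¬ StarAdj v v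
    starIrrefl (_ , inj₁ (c , l)) = l c
    starIrrefl (_ , inj₂ (l , c)) = l c

StarForest : (n : ℕ) → (Fin n → ℕ) → FinGraph
StarForest n s = record
  { V        = StarV n s
  ; Adj      = StarAdj {n} {s}
  ; vertices = starVertices n s
  ; complete = starComplete
  ; unique   = starUnique
  ; sym-Adj  = λ {u} {v} → starSym {n} {s} {u} {v}
  ; irrefl   = λ {v} → starIrrefl {n} {s} {v}
  }

-- Sums over [n] and over subsets of [n] (a subset A ⊆ [n] is given by its
-- characteristic function Fin n → Bool; its complement is B = [n] ∖ A).

sumFin : (n : ℕ) → (Fin n → ℕ) → ℕ
sumFin zero    f = 0
sumFin (suc n) f = f zero + sumFin n (λ i → f (suc i))

sumOver : (n : ℕ) → (Fin n → Bool) → (Fin n → ℕ) → ℕ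
sumOver n A f = sumFin n (λ i → if A i then f i else 0)

-- In a proper 2-coloring of a star every leaf gets the color opposite to the
-- center, so a proper 2-coloring of G is determined by the set A of stars
-- whose center has color 0; conversely every A gives a proper coloring.
-- Counting vertices star by star, a star whose center has color a
-- contributes 1 vertex to class a, and otherwise its m i + 1 leaves.  Hence
--   |class 0| = n + Σ_{i ∉ A} m i,      |class 1| = n + Σ_{i ∈ A} m i.
-- So the coloring is equitable iff the two partial sums differ by at most 1,
-- and since they add up to the even number Σ m i this forces equality.
module Submission where

open import Defs
open import Data.Nat using (ℕ; zero; suc; _+_; _*_; _≤_; s≤s)
open import Data.Nat.Properties
  using (+-suc; +-identityʳ; *-identityʳ; *-zeroʳ; n≤1+n; +-cancelˡ-≤; +-commutativeSemigroup)
import Algebra.Properties.CommutativeSemigroup as CommSemigroupProperties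
open import Data.Nat.Divisibility using (_∣_; ∣1⇒≡1; ∣m+n∣m⇒∣n; divides-refl)
open import Data.Fin using (Fin; zero; suc)
open import Data.Fin.Properties using (_≟_)
open import Data.Bool using (Bool; true; false; not; if_then_else_)
open import Data.Bool.Properties using (not-involutive)
open import Data.List using (List; _++_; map; concat; filter; length; tabulate)
open import Data.List.Properties using (length-++; filter-++; map-tabulate)
open import Data.Product using (Σ; _,_)
open import Data.Sum using (inj₁; inj₂)
open import Data.Empty using (⊥-elim)
open import Relation.Binary.PropositionalEquality
  using (_≡_; _≢_; refl; sym; trans; cong; cong₂; subst; subst₂; ≢-sym; module ≡-Reasoning)
open import Relation.Nullary using (Dec; does)
open import Function.Bundles using (_⇔_; mk⇔)

sumFin-cong : ∀ n {f g : Fin n → ℕ} → (∀ i → f i ≡ g i) → sumFin n f ≡ sumFin n g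
sumFin-cong zero    f≗g = refl
sumFin-cong (suc n) f≗g = cong₂ _+_ (f≗g zero) (sumFin-cong n (λ i → f≗g (suc i)))

sumFin-const : ∀ n c → sumFin n (λ _ → c) ≡ n * c
sumFin-const zero    c = refl
sumFin-const (suc n) c = cong (c +_) (sumFin-const n c)

sumFin-+ : ∀ n (f g : Fin n → ℕ) → sumFin n (λ i → f i + g i) ≡ sumFin n f + sumFin n g
sumFin-+ zero    f g = refl
sumFin-+ (suc n) f g = begin
  f zero + g zero + sumFin n (λ i → f (suc i) + g (suc i))
    ≡⟨ cong (f zero + g zero +_) (sumFin-+ n (λ i → f (suc i)) (λ i → g (suc i))) ⟩
  f zero + g zero + (sumFin n (λ i → f (suc i)) + sumFin n (λ i → g (suc i)))
    ≡⟨ interchange (f zero) (g zero) _ _ ⟩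
  f zero + sumFin n (λ i → f (suc i)) + (g zero + sumFin n (λ i → g (suc i))) ∎
  where
  open ≡-Reasoning
  open CommSemigroupProperties +-commutativeSemigroup using (interchange)

sumOver-cong : ∀ n {A B : Fin n → Bool} (f : Fin n → ℕ) → (∀ i → A i ≡ B i) → sumOver n A f ≡ sumOver n B f
sumOver-cong n f A≗B = sumFin-cong n (λ i → cong (λ b → if b then f i else 0) (A≗B i))

restrict : Bool → ℕ → ℕ
restrict b x = if b then x else 0

sumOver-split : ∀ n (A : Fin n → Bool) (f : Fin n → ℕ) →
                sumOver n A f + sumOver n (λ i → not (A i)) f ≡ sumFin n f
sumOver-split n A f =
  trans (sym (sumFin-+ n _ _)) (sumFin-cong n (λ i → restrict-split (A i) (f i)))
  where
  restrict-split : ∀ b x → restrict b x + restrict (not b) x ≡ x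
  restrict-split true  x = +-identityʳ x
  restrict-split false x = refl

sumFin-oneOrSuc : ∀ n (B : Fin n → Bool) (m : Fin n → ℕ) →
                  sumFin n (λ i → if B i then 1 else suc (m i)) ≡ n + sumOver n (λ i → not (B i)) m
sumFin-oneOrSuc n B m = begin
  sumFin n (λ i → if B i then 1 else suc (m i))
    ≡⟨ sumFin-cong n (λ i → oneOrSuc (B i) (m i)) ⟩
  sumFin n (λ i → 1 + restrict (not (B i)) (m i))
    ≡⟨ sumFin-+ n (λ _ → 1) _ ⟩
  sumFin n (λ _ → 1) + sumOver n (λ i → not (B i)) m
    ≡⟨ cong (_+ sumOver n (λ i → not (B i)) m) (trans (sumFin-const n 1) (*-identityʳ n)) ⟩
  n + sumOver n (λ i → not (B i)) m ∎
  where
  open ≡-Reasoning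
  oneOrSuc : ∀ b x → (if b then 1 else suc x) ≡ 1 + restrict (not b) x
  oneOrSuc true  x = refl
  oneOrSuc false x = refl


𝟙 : Bool → ℕ
𝟙 true  = 1
𝟙 false = 0

module Count {X : Set} {P : X → Set} (P? : ∀ x → Dec (P x)) where

  count : List X → ℕ
  count xs = length (filter P? xs)

  count-++ : ∀ xs ys → count (xs ++ ys) ≡ count xs + count ys
  count-++ xs ys = trans (cong length (filter-++ P? xs ys)) (length-++ (filter P? xs))

  count-tabulate : ∀ k (g : Fin k → X) → count (tabulate g) ≡ sumFin k (λ j → 𝟙 (does (P? (g j))))
  count-tabulate zero    g = refl
  count-tabulate (suc k) g with does (P? (g zero))
  ... | true  = cong suc (count-tabulate k (λ j → g (suc j)))
  ... | false = count-tabulate k (λ j → g (suc j))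

  count-concat : ∀ k (h : Fin k → List X) → count (concat (tabulate h)) ≡ sumFin k (λ j → count (h j))
  count-concat zero    h = refl
  count-concat (suc k) h =
    trans (count-++ (h zero) _) (cong (count (h zero) +_) (count-concat k (λ j → h (suc j))))


other : Fin 2 → Fin 2
other zero       = suc zero
other (suc zero) = zero

other-≢ : ∀ x → x ≢ other x
other-≢ zero       ()
other-≢ (suc zero) ()

≢⇒other : ∀ (x y : Fin 2) → x ≢ y → y ≡ other x
≢⇒other zero       zero       x≢y = ⊥-elim (x≢y refl)
≢⇒other zero       (suc zero) x≢y = refl
≢⇒other (suc zero) zero       x≢y = refl
≢⇒other (suc zero) (suc zero) x≢y = ⊥-elim (x≢y refl)

indicator-other : ∀ x a k → 𝟙 (does (x ≟ a)) + k * 𝟙 (does (other x ≟ a))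
                            ≡ (if does (x ≟ a) then 1 else k)
indicator-other zero       zero       k = cong suc (*-zeroʳ k)
indicator-other zero       (suc zero) k = *-identityʳ k
indicator-other (suc zero) zero       k = *-identityʳ k
indicator-other (suc zero) (suc zero) k = cong suc (*-zeroʳ k)

is-one : ∀ (x : Fin 2) → does (x ≟ suc zero) ≡ not (does (x ≟ zero))
is-one zero       = refl
is-one (suc zero) = refl

colorOf : Bool → Fin 2
colorOf true  = zero
colorOf false = suc zero

colorOf-is-zero : ∀ b → does (colorOf b ≟ zero) ≡ b
colorOf-is-zero true  = refl
colorOf-is-zero false = refl


module StarColoring (n : ℕ) (s : Fin n → ℕ) where

  G : FinGraph
  G = StarForest n s

  LeavesOpposite : (StarV n s → Fin 2) → Set
  LeavesOpposite c = ∀ i l → c (i , suc l) ≡ other (c (i , zero))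

  proper⇒leavesOpposite : ∀ c → Proper G 2 c → LeavesOpposite c
  proper⇒leavesOpposite c proper i l =
    ≢⇒other _ _ (proper (i , zero) (i , suc l) (refl , inj₁ (refl , λ ())))

  leavesOpposite⇒proper : ∀ c → LeavesOpposite c → Proper G 2 c
  leavesOpposite⇒proper c opp (i , zero)  (.i , zero)  (refl , inj₁ (_ , leaf)) = ⊥-elim (leaf refl)
  leavesOpposite⇒proper c opp (i , zero)  (.i , zero)  (refl , inj₂ (leaf , _)) = ⊥-elim (leaf refl)
  leavesOpposite⇒proper c opp (i , suc _) (.i , suc _) (refl , inj₁ (() , _))
  leavesOpposite⇒proper c opp (i , suc _) (.i , suc _) (refl , inj₂ (_ , ()))
  leavesOpposite⇒proper c opp (i , zero)  (.i , suc l) (refl , _) =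
    subst (c (i , zero) ≢_) (sym (opp i l)) (other-≢ (c (i , zero)))
  leavesOpposite⇒proper c opp (i , suc l) (.i , zero)  (refl , _) =
    ≢-sym (subst (c (i , zero) ≢_) (sym (opp i l)) (other-≢ (c (i , zero))))

  centersColored : (StarV n s → Fin 2) → Fin 2 → Fin n → Bool
  centersColored c a i = does (c (i , zero) ≟ a)

  classSize-stars : ∀ c → LeavesOpposite c → ∀ a →
    classSize G 2 c a ≡ sumFin n (λ i → if centersColored c a i then 1 else s i)
  classSize-stars c opp a = begin
    count (starVertices n s)
      ≡⟨ cong (λ blocks → count (concat blocks)) (map-tabulate (λ i → i) block) ⟩
    count (concat (tabulate block))
      ≡⟨ count-concat n block ⟩
    sumFin n (λ i → count (block i))
      ≡⟨ sumFin-cong n starCount ⟩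
    sumFin n (λ i → if centersColored c a i then 1 else s i) ∎
    where
    open ≡-Reasoning
    open Count (λ v → c v ≟ a)
    block : Fin n → List (StarV n s)
    block i = map (i ,_) (tabulate (λ j → j))
    starCount : ∀ i → count (block i) ≡ (if centersColored c a i then 1 else s i)
    starCount i = begin
      count (block i)
        ≡⟨ cong count (map-tabulate (λ j → j) (i ,_)) ⟩
      count (tabulate (i ,_))
        ≡⟨ count-tabulate (suc (s i)) (i ,_) ⟩
      𝟙 (does (x ≟ a)) + sumFin (s i) (λ l → 𝟙 (does (c (i , suc l) ≟ a)))
        ≡⟨ cong (𝟙 (does (x ≟ a)) +_) (sumFin-cong (s i) (λ l → cong (λ y → 𝟙 (does (y ≟ a))) (opp i l))) ⟩
      𝟙 (does (x ≟ a)) + sumFin (s i) (λ _ → 𝟙 (does (other x ≟ a)))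
        ≡⟨ cong (𝟙 (does (x ≟ a)) +_) (sumFin-const (s i) _) ⟩
      𝟙 (does (x ≟ a)) + s i * 𝟙 (does (other x ≟ a))
        ≡⟨ indicator-other x a (s i) ⟩
      (if does (x ≟ a) then 1 else s i) ∎
      where x = c (i , zero)

module StarForestSizes (n : ℕ) (m : Fin n → ℕ) where
  open StarColoring n (λ i → suc (m i)) public

  classSize-zero : ∀ c → LeavesOpposite c →
    classSize G 2 c zero ≡ n + sumOver n (λ i → not (centersColored c zero i)) m
  classSize-zero c opp =
    trans (classSize-stars c opp zero) (sumFin-oneOrSuc n (centersColored c zero) m)

  classSize-one : ∀ c → LeavesOpposite c →
    classSize G 2 c (suc zero) ≡ n + sumOver n (centersColored c zero) m
  classSize-one c opp = begin
    classSize G 2 c (suc zero)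
      ≡⟨ classSize-stars c opp (suc zero) ⟩
    sumFin n (λ i → if centersColored c (suc zero) i then 1 else suc (m i))
      ≡⟨ sumFin-oneOrSuc n (centersColored c (suc zero)) m ⟩
    n + sumOver n (λ i → not (centersColored c (suc zero) i)) m
      ≡⟨ cong (n +_) (sumOver-cong n m (λ i → cong not (is-one (c (i , zero))))) ⟩
    n + sumOver n (λ i → not (not (centersColored c zero i))) m
      ≡⟨ cong (n +_) (sumOver-cong n m (λ i → not-involutive _)) ⟩
    n + sumOver n (centersColored c zero) m ∎
    where open ≡-Reasoning


even-sum-close⇒≡ : ∀ x y → x ≤ suc y → y ≤ suc x → 2 ∣ x + y → x ≡ y
even-sum-close⇒≡ zero          zero          _       _       _    = refl
even-sum-close⇒≡ zero          (suc zero)    _       _       2∣x+y with () ← ∣1⇒≡1 2∣x+y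
even-sum-close⇒≡ zero          (suc (suc y)) _       (s≤s ()) _
even-sum-close⇒≡ (suc zero)    zero          _       _       2∣x+y with () ← ∣1⇒≡1 2∣x+y
even-sum-close⇒≡ (suc (suc x)) zero          (s≤s ()) _      _
even-sum-close⇒≡ (suc x)       (suc y)       (s≤s x≤1+y) (s≤s y≤1+x) 2∣x+y =
  cong suc (even-sum-close⇒≡ x y x≤1+y y≤1+x
    (∣m+n∣m⇒∣n (subst (2 ∣_) (cong suc (+-suc x y)) 2∣x+y) (divides-refl 1)))

offset-cancel : ∀ k x y → k + x ≤ suc (k + y) → x ≤ suc y
offset-cancel k x y le = +-cancelˡ-≤ k _ _ (subst (k + x ≤_) (sym (+-suc k y)) le)

equal-sizes-balanced : ∀ {k} (size : Fin k → ℕ) N → (∀ a → size a ≡ N) → ∀ a b → size a ≤ suc (size b)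
equal-sizes-balanced size N all≡N a b = subst₂ _≤_ (sym (all≡N a)) (cong suc (sym (all≡N b))) (n≤1+n N)


module _ (n : ℕ) (m : Fin n → ℕ) where
  open StarForestSizes n m

  partition⇒equitable : (A : Fin n → Bool) → sumOver n A m ≡ sumOver n (λ i → not (A i)) m →
                        EquitablyColorable G 2
  partition⇒equitable A balanced =
    c , leavesOpposite⇒proper c opp , equal-sizes-balanced (classSize G 2 c) _ sizes
    where
    c : StarV n (λ i → suc (m i)) → Fin 2
    c (i , zero)  = colorOf (A i)
    c (i , suc _) = other (colorOf (A i))
    opp : LeavesOpposite c
    opp i l = refl
    centers≡A : ∀ i → centersColored c zero i ≡ A i
    centers≡A i = colorOf-is-zero (A i)
    sizes : ∀ a → classSize G 2 c a ≡ n + sumOver n A m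
    sizes zero = trans (classSize-zero c opp) (cong (n +_)
      (trans (sumOver-cong n m (λ i → cong not (centers≡A i))) (sym balanced)))
    sizes (suc zero) = trans (classSize-one c opp) (cong (n +_)
      (sumOver-cong n m centers≡A))

  equitable⇒partition : 2 ∣ sumFin n m → EquitablyColorable G 2 →
                        Σ (Fin n → Bool) (λ A → sumOver n A m ≡ sumOver n (λ i → not (A i)) m)
  equitable⇒partition even (c , proper , balanced) =
    A , even-sum-close⇒≡ _ _ A≤¬A ¬A≤A (subst (2 ∣_) (sym (sumOver-split n A m)) even)
    where
    opp : LeavesOpposite c
    opp = proper⇒leavesOpposite c proper
    A : Fin n → Bool
    A = centersColored c zero
    A≤¬A : sumOver n A m ≤ suc (sumOver n (λ i → not (A i)) m)
    A≤¬A = offset-cancel n _ _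
      (subst₂ (λ x y → x ≤ suc y) (classSize-one c opp) (classSize-zero c opp) (balanced (suc zero) zero))
    ¬A≤A : sumOver n (λ i → not (A i)) m ≤ suc (sumOver n A m)
    ¬A≤A = offset-cancel n _ _
      (subst₂ (λ x y → x ≤ suc y) (classSize-zero c opp) (classSize-one c opp) (balanced zero (suc zero)))

lemma2p1 : (n : ℕ) → 1 ≤ n → (m : Fin n → ℕ) → (∀ i → 1 ≤ m i) → 2 ∣ sumFin n m →
           (Σ (Fin n → Bool) (λ A → sumOver n A m ≡ sumOver n (λ i → not (A i)) m))
           ⇔ EquitablyColorable (StarForest n (λ i → suc (m i))) 2
lemma2p1 n _ m _ even =
  mk⇔ (λ (A , balanced) → partition⇒equitable n m A balanced) (equitable⇒partition n m even)
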